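{- For every agent $a$, the relation $\succeq_a$ on pointed models is reflexive and transitive, and it satisfies the Church–Rosser property: whenever $N_t\succeq_a M_s$ and $N_t\succeq_a M'_{s'}$, there exists a pointed model $N'_{t'}$ with $M_s\succeq_a N'_{t'}$ and $M'_{s'}\succeq_a N'_{t'}$.
   Context: Fix a finite set $A$ of agents and a set $P$ of propositional variables. A model $M=(S,R,V)$ has a nonempty set $S$ of states, relations $R_a\subseteq S\times S$ for $a\in A$, and $V:P\to\mathcal P(S)$; $M_s$ with $s\in S$ is a pointed model and $sR_a=\{t\mid(s,t)\in R_a\}$. An $a$-refinement between $M$ and $M'=(S',R',V')$ is a nonempty relation $\mathfrak F\subseteq S\times S'$ such that for all $(s,s')\in\mathfrak F$: $s\in V(p)$ iff $s'\in V'(p)$ for all $p\in P$; for every $b\in A$ and $t'\in s'R'_b$ there is $t\in sR_b$ with $(t,t')\in\mathfrak F$; for every $b\in A\setminus\{a\}$ and $t\in sR_b$ there is $t'\in s'R'_b$ with $(t,t')\in\mathfrak F$. $M_s\succeq_a M'_{s'}$ iff some $a$-refinement contains $(s,s')$. -}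

module Defs where

open import Level using (0ℓ)
open import Data.Nat using (ℕ)
open import Data.Fin using (Fin)
open import Data.Product using (Σ; _×_; _,_; ∃)
open import Relation.Binary.PropositionalEquality using (_≡_)
open import Relation.Nullary using (¬_)
open import Function.Bundles using (_⇔_)

module Refinement (n : ℕ) (P : Set) where

  Agent : Set
  Agent = Fin n

  record Model : Set₁ where
    field
      S : Set
      nonempty : S
      R : Agent → S → S → Set      -- R a s t  means  (s , t) ∈ R_a
      V : P → S → Set
  open Model public

  record Pointed : Set₁ where
    constructor _,,_
    field
      model : Model
      point : S model
  open Pointed public

  record IsRefinement (a : Agent) (M M' : Model) (F : S M → S M' → Set) : Set where
    field
      nonemptyRel : Σ (S M) λ s → Σ (S M') λ s' → F s s'
      atoms : ∀ {s s'} → F s s' → ∀ p → V M p s ⇔ V M' p s'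
      back  : ∀ {s s'} → F s s' → ∀ b t' → R M' b s' t' →
                Σ (S M) λ t → R M b s t × F t t'
      forth : ∀ {s s'} → F s s' → ∀ b → ¬ (b ≡ a) → ∀ t → R M b s t →
                Σ (S M') λ t' → R M' b s' t' × F t t'

  _⪰[_]_ : Pointed → Agent → Pointed → Set₁
  (M ,, s) ⪰[ a ] (M' ,, s') =
    Σ (S M → S M' → Set) λ F → IsRefinement a M M' F × F s s'

-- Reflexivity and transitivity are witnessed by the identity relation and by relational
-- composition. For confluence, let N⁻ be N with all a-edges deleted. If F is an a-refinement
-- from N_t to M_s, its converse is an a-refinement from M_s to N⁻_t: the a-edges of N, for
-- which forth would fail, are exactly the ones that were deleted. So N⁻_t is a common
-- refinement of any two refinements of N_t.
module Submission where

open import Defs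
open import Level using (0ℓ)
open import Data.Nat using (ℕ)
open import Data.Product using (Σ; _×_; _,_)
open import Function.Base using (flip)
open import Function.Properties.Equivalence using (⇔-isEquivalence)
-- The library's composition operator is spelled with U+037E, not with the reserved ';'.
open import Relation.Binary.Construct.Composition using () renaming (_;_ to _⨾_)
open import Relation.Binary.PropositionalEquality using (_≡_; refl)
open import Relation.Binary.Structures using (IsEquivalence)
open import Relation.Nullary using (¬_)

module _ (n : ℕ) (P : Set) where
  open Defs.Refinement n P
  open IsRefinement
  open IsEquivalence (⇔-isEquivalence {ℓ = 0ℓ}) using ()
    renaming (refl to ⇔-refl; sym to ⇔-sym; trans to ⇔-trans)

  ≡-isRefinement : ∀ a M → IsRefinement a M M _≡_
  ≡-isRefinement a M = record
    { nonemptyRel = nonempty M , nonempty M , refl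
    ; atoms       = λ { refl p → ⇔-refl }
    ; back        = λ { refl b t' r → t' , r , refl }
    ; forth       = λ { refl b _ t r → t , r , refl }
    }

  ⨾-isRefinement : ∀ {a M N K F G} {s k} → IsRefinement a M N F → IsRefinement a N K G →
                   (F ⨾ G) s k → IsRefinement a M K (F ⨾ G)
  ⨾-isRefinement {s = s} {k} rF rG Fs⨾Gk = record
    { nonemptyRel = s , k , Fs⨾Gk
    ; atoms       = λ (_ , f , g) p → ⇔-trans (atoms rF f p) (atoms rG g p)
    ; back        = λ (_ , f , g) b z' r →
        let y' , r₁ , g' = back rG g b z' r
            x' , r₂ , f' = back rF f b y' r₁
        in x' , r₂ , y' , f' , g'
    ; forth       = λ (_ , f , g) b b≢a x' r →
        let y' , r₁ , f' = forth rF f b b≢a x' r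
            z' , r₂ , g' = forth rG g b b≢a y' r₁
        in z' , r₂ , y' , f' , g'
    }

  ⪰-refl : ∀ a Ms → Ms ⪰[ a ] Ms
  ⪰-refl a (M ,, s) = _≡_ , ≡-isRefinement a M , refl

  ⪰-trans : ∀ a Ms Ns Ks → Ms ⪰[ a ] Ns → Ns ⪰[ a ] Ks → Ms ⪰[ a ] Ks
  ⪰-trans a (M ,, s) (N ,, u) (K ,, k) (F , rF , Fsu) (G , rG , Guk) =
    F ⨾ G , ⨾-isRefinement rF rG (u , Fsu , Guk) , u , Fsu , Guk

  deleteEdges : Agent → Model → Model
  deleteEdges a N = record N { R = λ b x y → ¬ (b ≡ a) × R N b x y }

  flip-isRefinement : ∀ {a N M F} → IsRefinement a N M F →
                      IsRefinement a M (deleteEdges a N) (flip F)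
  flip-isRefinement rF = record
    { nonemptyRel = let t , s , f = nonemptyRel rF in s , t , f
    ; atoms       = λ f p → ⇔-sym (atoms rF f p)
    ; back        = λ f b y (b≢a , r) → forth rF f b b≢a y r
    ; forth       = λ f b b≢a m' r →
        let y , r₁ , f' = back rF f b m' r in y , (b≢a , r₁) , f'
    }

  ⪰-deleteEdges : ∀ a N t Ms → (N ,, t) ⪰[ a ] Ms → Ms ⪰[ a ] (deleteEdges a N ,, t)
  ⪰-deleteEdges a N t (M ,, s) (F , rF , Fts) = flip F , flip-isRefinement rF , Fts

  ⪰-churchRosser : ∀ a Nt Ms Ms' → Nt ⪰[ a ] Ms → Nt ⪰[ a ] Ms' →
                   Σ Pointed λ N't' → (Ms ⪰[ a ] N't') × (Ms' ⪰[ a ] N't')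
  ⪰-churchRosser a (N ,, t) Ms Ms' Nt⪰Ms Nt⪰Ms' =
    (deleteEdges a N ,, t) , ⪰-deleteEdges a N t Ms Nt⪰Ms , ⪰-deleteEdges a N t Ms' Nt⪰Ms'

proposition1 : (n : ℕ) (P : Set) → let open Defs.Refinement n P in
    (a : Agent) →
    ((Ms : Pointed) → Ms ⪰[ a ] Ms)
    × ((Ms Ns Ks : Pointed) → Ms ⪰[ a ] Ns → Ns ⪰[ a ] Ks → Ms ⪰[ a ] Ks)
    × ((Nt Ms Ms' : Pointed) → Nt ⪰[ a ] Ms → Nt ⪰[ a ] Ms' →
    Σ Pointed λ N't' → (Ms ⪰[ a ] N't') × (Ms' ⪰[ a ] N't'))
proposition1 n P a = ⪰-refl n P a , ⪰-trans n P a , ⪰-churchRosser n P a
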